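{- Let $G=(U\cup W,E)$ be a circular graph. (i) If $G$ is a trivial circular graph, then $\mathrm{diam}(G)=2$ and $\mathrm{rad}(G)=1$. (ii) If $G$ is a non-trivial circular graph, then $3\le \mathrm{diam}(G)\le 4$ and $\mathrm{rad}(G)=3$.
   Context: All graphs are finite and simple. The eccentricity of a vertex is its maximum distance to other vertices; $\mathrm{diam}(G)$ is the maximum and $\mathrm{rad}(G)$ the minimum eccentricity. For vertices $v_1,\dots,v_k$, $cn(v_1,\dots,v_k)$ denotes the number of common neighbours of $v_1,\dots,v_k$. A circular graph is a finite bipartite graph $G$ with a specified bipartition $V(G)=U\cup W$ into nonempty sets ($U\cap W=\emptyset$, every edge joins $U$ to $W$) such that (i) $cn(u_i,u_j,u_k)=1$ for all distinct $u_i,u_j,u_k\in U$, and (ii) $d(w)\ge 3$ for every $w\in W$. It is trivial if $|U|=1$ or $|W|=1$, and non-trivial otherwise. -}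

module Defs where

open import Data.Nat using (ℕ; zero; suc; _+_; _≤_)
open import Data.Fin using (Fin; zero; suc)
open import Data.Bool using (Bool; true; false; T; _∧_; not)
open import Data.Sum using (_⊎_)
open import Data.Product using (Σ; ∃; _×_; _,_)
open import Relation.Binary.PropositionalEquality using (_≡_; _≢_)

b2n : Bool → ℕ
b2n true  = 1
b2n false = 0

count : ∀ {n} → (Fin n → Bool) → ℕ
count {zero}  p = 0
count {suc n} p = b2n (p zero) + count (λ i → p (suc i))

record Graph : Set where
  field
    n     : ℕ
    adj   : Fin n → Fin n → Bool
    sym   : ∀ x y → adj x y ≡ adj y x
    irrefl : ∀ x → adj x x ≡ false
open Graph public

data Walk (G : Graph) : ℕ → Fin (n G) → Fin (n G) → Set where
  here : ∀ x → Walk G 0 x x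
  step : ∀ {k x y z} → T (adj G x y) → Walk G k y z → Walk G (suc k) x z

Dist : (G : Graph) → Fin (n G) → Fin (n G) → ℕ → Set
Dist G x y k = Walk G k x y × (∀ j → Walk G j x y → k ≤ j)

Ecc : (G : Graph) → Fin (n G) → ℕ → Set
Ecc G x e = (∀ y → ∃ λ k → Dist G x y k × k ≤ e) × (∃ λ y → Dist G x y e)

Diam : Graph → ℕ → Set
Diam G D = (∃ λ x → Ecc G x D) × (∀ x e → Ecc G x e → e ≤ D)

Rad : Graph → ℕ → Set
Rad G R = (∃ λ x → Ecc G x R) × (∀ x e → Ecc G x e → R ≤ e)

cn3 : (G : Graph) → Fin (n G) → Fin (n G) → Fin (n G) → ℕ
cn3 G a b c = count (λ v → adj G a v ∧ adj G b v ∧ adj G c v)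

deg : (G : Graph) → Fin (n G) → ℕ
deg G v = count (adj G v)

-- A circular graph: G with bipartition given by inU (true = U, false = W).
record IsCircular (G : Graph) (inU : Fin (n G) → Bool) : Set where
  field
    U-nonempty : ∃ λ u → inU u ≡ true
    W-nonempty : ∃ λ w → inU w ≡ false
    bipartite  : ∀ x y → T (adj G x y) → inU x ≢ inU y
    cn-one     : ∀ a b c → inU a ≡ true → inU b ≡ true → inU c ≡ true →
                 a ≢ b → a ≢ c → b ≢ c → cn3 G a b c ≡ 1
    deg-W      : ∀ w → inU w ≡ false → 3 ≤ deg G w

sizeU : (G : Graph) → (Fin (n G) → Bool) → ℕ
sizeU G inU = count inU

sizeW : (G : Graph) → (Fin (n G) → Bool) → ℕ
sizeW G inU = count (λ v → not (inU v))

Trivial : (G : Graph) → (Fin (n G) → Bool) → Set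
Trivial G inU = (sizeU G inU ≡ 1) ⊎ (sizeW G inU ≡ 1)

NonTrivial : (G : Graph) → (Fin (n G) → Bool) → Set
NonTrivial G inU = (sizeU G inU ≢ 1) × (sizeW G inU ≢ 1)

module Submission where

-- Every W-vertex has at least three neighbours in U, and three U-vertices have exactly one
-- common neighbour. Hence any two U-vertices have a common neighbour, so d(u,u′) ≤ 2,
-- d(u,w) ≤ 3 and d(w,w′) ≤ 4, while two distinct W-vertices share at most two neighbours.
-- If |W| = 1 (|U| = 1 is impossible) the W-vertex is adjacent to all of U, giving
-- eccentricities 1 and 2. If |W| ≥ 2, no vertex is adjacent to the whole opposite side, so by
-- bipartiteness every vertex has a vertex at distance ≥ 3, and U-vertices have eccentricity
-- exactly 3; the diameter is 4 or 3 according to whether two W-vertices lack a common neighbour.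

open import Defs hiding (sym)
open import Data.Nat using (ℕ; zero; suc; _+_; _≤_; _<_; z≤n; s≤s; s≤s⁻¹)
open import Data.Nat.Properties
  using (≤-refl; ≤-trans; <-irrefl; n≤1+n; <⇒≤; ≮⇒≥; ≤∧≢⇒<; +-mono-≤; +-monoˡ-≤; m≤m+n;
         anyUpTo?; +-commutativeSemigroup)
open import Data.Nat.Induction using (<-rec)
open import Data.Fin using (Fin; zero; suc)
open import Data.Fin.Properties using (_≟_; any?)
open import Data.Bool using (Bool; true; false; T; not; _∧_; if_then_else_)
import Data.Bool.Properties as B
open import Data.Bool.Properties using (T?; T-≡; T-not-≡; T-∧; not-involutive; not-¬; ¬-not)
open import Data.Empty using (⊥-elim)
open import Data.Sum using (_⊎_; inj₁; inj₂; [_,_])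
open import Data.Product using (∃; _×_; _,_; proj₂)
open import Function using (_∘_; Equivalence)
open import Relation.Nullary using (¬_; Dec; yes; no; does; contradiction)
open import Relation.Nullary.Decidable using (_×-dec_; ¬?; decidable-stable)
open import Relation.Unary using (Decidable)
open import Relation.Binary.PropositionalEquality
  using (_≡_; _≢_; refl; sym; trans; cong; cong₂; subst)
open Relation.Binary.PropositionalEquality.≡-Reasoning
open import Algebra.Properties.CommutativeSemigroup +-commutativeSemigroup using (x∙yz≈y∙xz)

infixl 6 _-_

_-_ : ∀ {n} → (Fin n → Bool) → Fin n → Fin n → Bool
(p - a) i = if does (i ≟ a) then false else p i

remove-T : ∀ {n} (p : Fin n → Bool) {a i} → i ≢ a → T (p i) → T ((p - a) i)
remove-T p {a} {i} i≢a pi with i ≟ a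
... | yes i≡a = contradiction i≡a i≢a
... | no _    = pi

remove-T⁻ : ∀ {n} (p : Fin n → Bool) {a i} → T ((p - a) i) → T (p i) × i ≢ a
remove-T⁻ p {a} {i} t with i ≟ a
... | no i≢a = t , i≢a

b2n≤1 : ∀ b → b2n b ≤ 1
b2n≤1 true  = s≤s z≤n
b2n≤1 false = z≤n

count-split : ∀ {n} (p : Fin n → Bool) a → count p ≡ b2n (p a) + count (p - a)
count-split p zero    = refl
count-split p (suc a) = begin
  b2n (p zero) + count (p ∘ suc)
    ≡⟨ cong (b2n (p zero) +_) (count-split (p ∘ suc) a) ⟩
  b2n (p zero) + (b2n (p (suc a)) + count (p ∘ suc - a))
    ≡⟨ x∙yz≈y∙xz (b2n (p zero)) (b2n (p (suc a))) (count (p ∘ suc - a)) ⟩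
  b2n (p (suc a)) + (b2n (p zero) + count (p ∘ suc - a)) ∎

count-empty : ∀ {n} (p : Fin n → Bool) → (∀ i → ¬ T (p i)) → count p ≡ 0
count-empty {zero}  p none = refl
count-empty {suc n} p none with p zero in eq
... | true  = contradiction (subst T (sym eq) _) (none zero)
... | false = count-empty (p ∘ suc) (none ∘ suc)

0<count⇒∃ : ∀ {n} (p : Fin n → Bool) → 1 ≤ count p → ∃ λ i → T (p i)
0<count⇒∃ p 0<count with any? (T? ∘ p)
... | yes found = found
... | no none    =
  contradiction (subst (1 ≤_) (count-empty p (λ i pi → none (i , pi))) 0<count) λ ()

T⇒1≤b2n : ∀ {b} → T b → 1 ≤ b2n b
T⇒1≤b2n {true} _ = s≤s z≤n

T⇒b2n≡1 : ∀ {b} → T b → b2n b ≡ 1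
T⇒b2n≡1 {true} _ = refl

∃⇒0<count : ∀ {n} (p : Fin n → Bool) {a} → T (p a) → 1 ≤ count p
∃⇒0<count p {a} pa =
  subst (1 ≤_) (sym (count-split p a)) (≤-trans (T⇒1≤b2n pa) (m≤m+n _ _))

count≡1⇒unique : ∀ {n} (p : Fin n → Bool) → count p ≡ 1 →
                 ∀ {i j} → T (p i) → T (p j) → i ≡ j
count≡1⇒unique p count≡1 {i} {j} pi pj with j ≟ i
... | yes j≡i = sym j≡i
... | no  j≢i = contradiction (subst (2 ≤_) count≡1 2≤count) (<-irrefl refl)
  where
  2≤count : 2 ≤ count p
  2≤count = subst (2 ≤_) (sym (count-split p i))
              (+-mono-≤ (T⇒1≤b2n pi) (∃⇒0<count (p - i) (remove-T p j≢i pj)))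

unique⇒count≡1 : ∀ {n} (p : Fin n → Bool) {a} → T (p a) → (∀ i → T (p i) → i ≡ a) → count p ≡ 1
unique⇒count≡1 p {a} pa only-a = begin
  count p                   ≡⟨ count-split p a ⟩
  b2n (p a) + count (p - a) ≡⟨ cong₂ _+_ (T⇒b2n≡1 pa) (count-empty (p - a) none) ⟩
  1 ∎
  where
  none : ∀ i → ¬ T ((p - a) i)
  none i t = let pi , i≢a = remove-T⁻ p t in i≢a (only-a i pi)

count≤1+count-remove : ∀ {n} (p : Fin n → Bool) a → count p ≤ 1 + count (p - a)
count≤1+count-remove p a = subst (_≤ 1 + count (p - a)) (sym (count-split p a))
                             (+-monoˡ-≤ (count (p - a)) (b2n≤1 (p a)))

3≤count⇒∃-avoiding : ∀ {n} (p : Fin n → Bool) → 3 ≤ count p →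
                     ∀ a b → ∃ λ c → T (p c) × c ≢ a × c ≢ b
3≤count⇒∃-avoiding p 3≤count a b =
  let c , t     = 0<count⇒∃ (p - a - b) 1≤count
      t′ , c≢b  = remove-T⁻ (p - a) t
      pc , c≢a  = remove-T⁻ p t′
  in c , pc , c≢a , c≢b
  where
  1≤count : 1 ≤ count (p - a - b)
  1≤count = s≤s⁻¹ (s≤s⁻¹ (≤-trans 3≤count
              (≤-trans (count≤1+count-remove p a) (s≤s (count≤1+count-remove (p - a) b)))))

all-or-counterexample : ∀ {n} {P Q : Fin n → Set} → Decidable P → Decidable Q →
                        (∀ i → P i → Q i) ⊎ ∃ λ i → P i × ¬ Q i
all-or-counterexample P? Q? with any? (λ i → P? i ×-dec ¬? (Q? i))
... | yes counterexample = inj₂ counterexample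
... | no  none           = inj₁ λ i p → decidable-stable (Q? i) (λ ¬q → none (i , p , ¬q))

module Walks (G : Graph) where

  V : Set
  V = Fin (n G)

  Adj : V → V → Set
  Adj x y = T (adj G x y)

  Adj-sym : ∀ {x y} → Adj x y → Adj y x
  Adj-sym {x} {y} = subst T (Graph.sym G x y)

  edge : ∀ {x y} → Adj x y → Walk G 1 x y
  edge xy = step xy (here _)

  infixr 5 _++_
  _++_ : ∀ {k l x y z} → Walk G k x y → Walk G l y z → Walk G (k + l) x z
  here _      ++ v = v
  step xy u ++ v = step xy (u ++ v)

  walk0⇒≡ : ∀ {x y} → Walk G 0 x y → x ≡ y
  walk0⇒≡ (here _) = refl

  walk1⇒Adj : ∀ {x y} → Walk G 1 x y → Adj x y
  walk1⇒Adj (step xy (here _)) = xy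

  walk? : ∀ k x y → Dec (Walk G k x y)
  walk? zero x y with x ≟ y
  ... | yes refl = yes (here x)
  ... | no  x≢y  = no (x≢y ∘ walk0⇒≡)
  walk? (suc k) x y with any? (λ z → T? (adj G x z) ×-dec walk? k z y)
  ... | yes (z , xz , w) = yes (step xz w)
  ... | no  none         = no λ { (step xz w) → none (_ , xz , w) }

  Dist≤ : V → V → ℕ → Set
  Dist≤ x y b = ∃ λ l → l ≤ b × Walk G l x y

  Dist≥ : V → V → ℕ → Set
  Dist≥ x y m = ∀ k → Walk G k x y → m ≤ k

  Dist≥-zero : ∀ {x y} → Dist≥ x y 0
  Dist≥-zero _ _ = z≤n

  Dist≥-suc : ∀ {x y m} → Dist≥ x y m → ¬ Walk G m x y → Dist≥ x y (suc m)
  Dist≥-suc m≤ ¬walk k w = ≤∧≢⇒< (m≤ k w) λ { refl → ¬walk w }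

  Dist≤-weaken : ∀ {x y b b′} → b ≤ b′ → Dist≤ x y b → Dist≤ x y b′
  Dist≤-weaken b≤b′ (l , l≤b , w) = l , ≤-trans l≤b b≤b′ , w

  ≢⇒Dist≥1 : ∀ {x y} → x ≢ y → Dist≥ x y 1
  ≢⇒Dist≥1 x≢y = Dist≥-suc Dist≥-zero (x≢y ∘ walk0⇒≡)

  shortest-walk : ∀ {x y} l → Walk G l x y → ∃ λ k → Dist G x y k × k ≤ l
  shortest-walk {x} {y} = <-rec _ go
    where
    go : ∀ l → (∀ {m} → m < l → Walk G m x y → ∃ λ k → Dist G x y k × k ≤ m) →
         Walk G l x y → ∃ λ k → Dist G x y k × k ≤ l
    go l shorter w with anyUpTo? (λ m → walk? m x y) l
    ... | yes (m , m<l , wm) = let k , d , k≤m = shorter m<l wm in k , d , ≤-trans k≤m (<⇒≤ m<l)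
    ... | no  none           = l , (w , λ k wk → ≮⇒≥ λ k<l → none (k , k<l , wk)) , ≤-refl

  Dist≤⇒Dist : ∀ {x y b} → Dist≤ x y b → ∃ λ k → Dist G x y k × k ≤ b
  Dist≤⇒Dist (l , l≤b , w) = let k , d , k≤l = shortest-walk l w in k , d , ≤-trans k≤l l≤b

  Ecc-intro : ∀ {x y e} → (∀ z → Dist≤ x z e) → Walk G e x y → Dist≥ x y e → Ecc G x e
  Ecc-intro within w far = (λ z → Dist≤⇒Dist (within z)) , (_ , w , far)

  Ecc-≥ : ∀ {x y e m} → Ecc G x e → Dist≥ x y m → m ≤ e
  Ecc-≥ {y = y} (within , _) far = let k , (w , _) , k≤e = within y in ≤-trans (far k w) k≤e

  Ecc-≤ : ∀ {x e b} → Ecc G x e → (∀ y → Dist≤ x y b) → e ≤ b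
  Ecc-≤ (_ , y , _ , minimal) within = let l , l≤b , w = within y in ≤-trans (minimal l w) l≤b

  Diam-intro : ∀ {x D} → Ecc G x D → (∀ y z → Dist≤ y z D) → Diam G D
  Diam-intro ecc within = (_ , ecc) , λ y e ecc′ → Ecc-≤ ecc′ (within y)

  Rad-intro : ∀ {x R} → Ecc G x R → (∀ y → ∃ λ z → Dist≥ y z R) → Rad G R
  Rad-intro ecc far = (_ , ecc) , λ y e ecc′ → let z , yz = far y in Ecc-≥ ecc′ yz

module Bipartite (G : Graph) (side : Fin (n G) → Bool)
                 (bipartite : ∀ x y → T (adj G x y) → side x ≢ side y) where
  open Walks G

  Adj⇒opposite : ∀ {x y} → Adj x y → side y ≡ not (side x)
  Adj⇒opposite {x} {y} xy = ¬-not (bipartite x y xy ∘ sym)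

  walk0⇒same : ∀ {x y} → Walk G 0 x y → side y ≡ side x
  walk0⇒same (here _) = refl

  walk2⇒same : ∀ {x y} → Walk G 2 x y → side y ≡ side x
  walk2⇒same (step xz (step zy (here _))) =
    trans (Adj⇒opposite zy) (trans (cong not (Adj⇒opposite xz)) (not-involutive _))

  walk1⇒opposite : ∀ {x y} → Walk G 1 x y → side y ≡ not (side x)
  walk1⇒opposite = Adj⇒opposite ∘ walk1⇒Adj

  walk3⇒opposite : ∀ {x y} → Walk G 3 x y → side y ≡ not (side x)
  walk3⇒opposite (step xz w) = trans (walk2⇒same w) (Adj⇒opposite xz)

  opposite-nonadjacent⇒Dist≥3 : ∀ {x y} → side y ≡ not (side x) → ¬ Adj x y → Dist≥ x y 3
  opposite-nonadjacent⇒Dist≥3 opp ¬xy =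
    Dist≥-suc (Dist≥-suc (Dist≥-suc Dist≥-zero (λ w → not-¬ (walk0⇒same w) opp))
                         (¬xy ∘ walk1⇒Adj))
              (λ w → not-¬ (walk2⇒same w) opp)

  same-side⇒Dist≥2 : ∀ {x y} → side y ≡ side x → x ≢ y → Dist≥ x y 2
  same-side⇒Dist≥2 same x≢y = Dist≥-suc (≢⇒Dist≥1 x≢y) (not-¬ same ∘ walk1⇒opposite)

  same-side⇒Dist≥4 : ∀ {x y} → side y ≡ side x → x ≢ y → ¬ Walk G 2 x y → Dist≥ x y 4
  same-side⇒Dist≥4 same x≢y ¬w2 =
    Dist≥-suc (Dist≥-suc (same-side⇒Dist≥2 same x≢y) ¬w2) (not-¬ same ∘ walk3⇒opposite)

module Circular (G : Graph) (inU : Fin (n G) → Bool) (C : IsCircular G inU) where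
  open IsCircular C
  open Walks G
  open Bipartite G inU bipartite

  U W : V → Set
  U x = inU x ≡ true
  W x = inU x ≡ false

  U⊎W : ∀ x → U x ⊎ W x
  U⊎W x with inU x
  ... | true  = inj₁ refl
  ... | false = inj₂ refl

  U⇒T : ∀ {x} → U x → T (inU x)
  U⇒T = Equivalence.from T-≡

  W⇒T : ∀ {x} → W x → T (not (inU x))
  W⇒T = Equivalence.from T-not-≡

  U-W-opposite : ∀ {x y} → U x → W y → inU y ≡ not (inU x)
  U-W-opposite ux wy = trans wy (cong not (sym ux))

  W-U-opposite : ∀ {x y} → W x → U y → inU y ≡ not (inU x)
  W-U-opposite wx uy = trans uy (cong not (sym wx))

  U≢W : ∀ {x y} → U x → W y → x ≢ y
  U≢W ux wy refl with trans (sym ux) wy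
  ... | ()

  W-nbr⇒U : ∀ {w x} → W w → Adj w x → U x
  W-nbr⇒U ww wx = trans (Adj⇒opposite wx) (cong not ww)

  U-nbr⇒W : ∀ {u x} → U u → Adj u x → W x
  U-nbr⇒W uu ux = trans (Adj⇒opposite ux) (cong not uu)

  W-nbr-avoiding : ∀ {w} → W w → ∀ a b → ∃ λ c → Adj w c × c ≢ a × c ≢ b
  W-nbr-avoiding {w} ww = 3≤count⇒∃-avoiding (adj G w) (deg-W w ww)

  CommonNbr : V → V → V → V → Set
  CommonNbr a b c z = Adj a z × Adj b z × Adj c z

  common-nbr : ∀ {a b c} → cn3 G a b c ≡ 1 → ∃ (CommonNbr a b c)
  common-nbr {a} {b} {c} e =
    let z , t   = 0<count⇒∃ (λ v → adj G a v ∧ adj G b v ∧ adj G c v) (subst (1 ≤_) (sym e) ≤-refl)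
        az , t′ = Equivalence.to T-∧ t
    in z , az , Equivalence.to (T-∧ {adj G b z}) t′

  common-nbr-unique : ∀ {a b c z z′} → cn3 G a b c ≡ 1 →
                      CommonNbr a b c z → CommonNbr a b c z′ → z ≡ z′
  common-nbr-unique {a} {b} {c} e (az , bz , cz) (az′ , bz′ , cz′) =
    count≡1⇒unique _ e (T-∧₃ az bz cz) (T-∧₃ az′ bz′ cz′)
    where
    T-∧₃ : ∀ {z} → Adj a z → Adj b z → Adj c z → T (adj G a z ∧ adj G b z ∧ adj G c z)
    T-∧₃ az bz cz = Equivalence.from T-∧ (az , Equivalence.from T-∧ (bz , cz))

  U-common-nbr : ∀ {u v} → U u → U v → u ≢ v → ∃ λ z → Adj u z × Adj v z
  U-common-nbr {u} {v} uu uv u≢v =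
    let w , ww = W-nonempty
        c , wc , c≢u , c≢v = W-nbr-avoiding ww u v
        uc = W-nbr⇒U ww wc
        z , uz , vz , _ = common-nbr (cn-one u v c uu uv uc u≢v (c≢u ∘ sym) (c≢v ∘ sym))
    in z , uz , vz

  U-has-nbr : ∀ {u} → U u → ∃ (Adj u)
  U-has-nbr {u} uu =
    let w , ww = W-nonempty
        a , wa , a≢u , _ = W-nbr-avoiding ww u u
        z , uz , _ = U-common-nbr uu (W-nbr⇒U ww wa) (a≢u ∘ sym)
    in z , uz

  W-has-nbr : ∀ {w} → W w → ∃ (Adj w)
  W-has-nbr {w} ww = let a , wa , _ = W-nbr-avoiding ww w w in a , wa

  U-walk2 : ∀ {u v} → U u → U v → Walk G 2 u v
  U-walk2 {u} {v} uu uv with u ≟ v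
  ... | yes refl = let z , uz = U-has-nbr uu in step uz (edge (Adj-sym uz))
  ... | no  u≢v  = let z , uz , vz = U-common-nbr uu uv u≢v in step uz (edge (Adj-sym vz))

  Dominates : V → Set
  Dominates w = ∀ u → U u → Adj w u

  dominating-unique : ∀ {w w′} → Dominates w → W w′ → w′ ≡ w
  dominating-unique {w′ = w′} dom ww′ =
    let a , w′a , _         = W-nbr-avoiding ww′ w′ w′
        b , w′b , b≢a , _   = W-nbr-avoiding ww′ a a
        c , w′c , c≢a , c≢b = W-nbr-avoiding ww′ a b
        ua = W-nbr⇒U ww′ w′a ; ub = W-nbr⇒U ww′ w′b ; uc = W-nbr⇒U ww′ w′c
    in common-nbr-unique (cn-one a b c ua ub uc (b≢a ∘ sym) (c≢a ∘ sym) (c≢b ∘ sym))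
         (Adj-sym w′a , Adj-sym w′b , Adj-sym w′c)
         (Adj-sym (dom a ua) , Adj-sym (dom b ub) , Adj-sym (dom c uc))

  -- A U-vertex c missed by w has, with two neighbours a, b of w, a common neighbour z ∈ W;
  -- then z and w are both common neighbours of u, a, b, so z ≡ w is adjacent to c after all.
  U-universal⇒dominating : ∀ {u w} → U u → (∀ w′ → W w′ → Adj u w′) → W w → Dominates w
  U-universal⇒dominating {u} {w} uu universal ww c uc = decidable-stable (T? (adj G w c)) ¬¬wc
    where
    nbr≢c : ¬ Adj w c → ∀ {x} → Adj w x → x ≢ c
    nbr≢c ¬wc wx refl = ¬wc wx

    ¬¬wc : ¬ ¬ Adj w c
    ¬¬wc ¬wc =
      let a , wa , a≢u , _   = W-nbr-avoiding ww u u
          b , wb , b≢u , b≢a = W-nbr-avoiding ww u a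
          ua = W-nbr⇒U ww wa ; ub = W-nbr⇒U ww wb
          z , az , bz , cz =
            common-nbr (cn-one a b c ua ub uc (b≢a ∘ sym) (nbr≢c ¬wc wa) (nbr≢c ¬wc wb))
          z≡w = common-nbr-unique (cn-one u a b uu ua ub (a≢u ∘ sym) (b≢u ∘ sym) (b≢a ∘ sym))
                  (universal z (U-nbr⇒W ua az) , az , bz) (universal w ww , Adj-sym wa , Adj-sym wb)
      in ¬wc (Adj-sym (subst (Adj c) z≡w cz))

  another-W : sizeW G inU ≢ 1 → ∀ {w} → W w → ∃ λ w′ → W w′ × w′ ≢ w
  another-W |W|≢1 {w} ww with all-or-counterexample (λ x → inU x B.≟ false) (_≟ w)
  ... | inj₂ w′     = w′
  ... | inj₁ only-w =
    contradiction (unique⇒count≡1 _ (W⇒T ww) (λ x → only-w x ∘ Equivalence.to T-not-≡)) |W|≢1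

  U-non-nbr : sizeW G inU ≢ 1 → ∀ {u} → U u → ∃ λ w → W w × ¬ Adj u w
  U-non-nbr |W|≢1 {u} uu with all-or-counterexample (λ x → inU x B.≟ false) (T? ∘ adj G u)
  ... | inj₂ w         = w
  ... | inj₁ universal =
    let w , ww = W-nonempty
        w′ , ww′ , w′≢w = another-W |W|≢1 ww
    in contradiction (dominating-unique (U-universal⇒dominating uu universal ww) ww′) w′≢w

  W-non-nbr : sizeW G inU ≢ 1 → ∀ {w} → W w → ∃ λ u → U u × ¬ Adj w u
  W-non-nbr |W|≢1 {w} ww with all-or-counterexample (λ x → inU x B.≟ true) (T? ∘ adj G w)
  ... | inj₂ u         = u
  ... | inj₁ dominates =
    let w′ , ww′ , w′≢w = another-W |W|≢1 ww
    in contradiction (dominating-unique dominates ww′) w′≢w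

  |U|≢1 : sizeU G inU ≢ 1
  |U|≢1 |U|≡1 =
    let w , ww           = W-nonempty
        a , wa , _       = W-nbr-avoiding ww w w
        b , wb , b≢a , _ = W-nbr-avoiding ww a a
    in b≢a (count≡1⇒unique inU |U|≡1 (U⇒T (W-nbr⇒U ww wb)) (U⇒T (W-nbr⇒U ww wa)))

  single-W : sizeW G inU ≡ 1 → Diam G 2 × Rad G 1
  single-W |W|≡1 with W-nonempty
  ... | w₀ , ww₀ with W-nbr-avoiding ww₀ w₀ w₀
  ... | u₀ , w₀u₀ , _ with W-nbr-avoiding ww₀ u₀ u₀
  ... | v , w₀v , v≢u₀ , _ = Diam-intro ecc-u₀ within2 , Rad-intro ecc-w₀ far1
    where
    uu₀ : U u₀
    uu₀ = W-nbr⇒U ww₀ w₀u₀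

    only-w₀ : ∀ {w} → W w → w ≡ w₀
    only-w₀ ww = count≡1⇒unique (not ∘ inU) |W|≡1 (W⇒T ww) (W⇒T ww₀)

    w₀-dominates : Dominates w₀
    w₀-dominates u uu =
      let z , uz = U-has-nbr uu in Adj-sym (subst (Adj u) (only-w₀ (U-nbr⇒W uu uz)) uz)

    within1 : ∀ y → Dist≤ w₀ y 1
    within1 y with U⊎W y
    ... | inj₁ uy = 1 , ≤-refl , edge (w₀-dominates y uy)
    ... | inj₂ wy rewrite only-w₀ wy = 0 , z≤n , here w₀

    within2 : ∀ x y → Dist≤ x y 2
    within2 x y with U⊎W x | U⊎W y
    ... | inj₁ ux | inj₁ uy = 2 , ≤-refl , U-walk2 ux uy
    ... | inj₁ ux | inj₂ wy rewrite only-w₀ wy = 1 , s≤s z≤n , edge (Adj-sym (w₀-dominates x ux))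
    ... | inj₂ wx | _       rewrite only-w₀ wx = Dist≤-weaken (s≤s z≤n) (within1 y)

    ecc-w₀ : Ecc G w₀ 1
    ecc-w₀ = Ecc-intro within1 (edge w₀u₀) (≢⇒Dist≥1 (U≢W uu₀ ww₀ ∘ sym))

    ecc-u₀ : Ecc G u₀ 2
    ecc-u₀ = Ecc-intro (within2 u₀) (edge (Adj-sym w₀u₀) ++ edge w₀v)
               (same-side⇒Dist≥2 (trans (W-nbr⇒U ww₀ w₀v) (sym uu₀)) (v≢u₀ ∘ sym))

    far1 : ∀ x → ∃ λ y → Dist≥ x y 1
    far1 x with U⊎W x
    ... | inj₁ ux = w₀ , ≢⇒Dist≥1 (U≢W ux ww₀)
    ... | inj₂ wx = u₀ , ≢⇒Dist≥1 (U≢W uu₀ wx ∘ sym)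

  U-W-walk3 : ∀ {u w} → U u → W w → Walk G 3 u w
  U-W-walk3 uu ww = let v , wv = W-has-nbr ww in U-walk2 uu (W-nbr⇒U ww wv) ++ edge (Adj-sym wv)

  W-U-walk3 : ∀ {w u} → W w → U u → Walk G 3 w u
  W-U-walk3 ww uu = let v , wv = W-has-nbr ww in edge wv ++ U-walk2 (W-nbr⇒U ww wv) uu

  W-W-walk4 : ∀ {w w′} → W w → W w′ → Walk G 4 w w′
  W-W-walk4 ww ww′ = let v , wv = W-has-nbr ww in edge wv ++ U-W-walk3 (W-nbr⇒U ww wv) ww′

  U-within3 : ∀ {u} → U u → ∀ y → Dist≤ u y 3
  U-within3 uu y with U⊎W y
  ... | inj₁ uy = 2 , n≤1+n 2 , U-walk2 uu uy
  ... | inj₂ wy = 3 , ≤-refl , U-W-walk3 uu wy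

  within4 : ∀ x y → Dist≤ x y 4
  within4 x y with U⊎W x | U⊎W y
  ... | inj₁ ux | _       = Dist≤-weaken (n≤1+n 3) (U-within3 ux y)
  ... | inj₂ wx | inj₁ uy = 3 , n≤1+n 3 , W-U-walk3 wx uy
  ... | inj₂ wx | inj₂ wy = 4 , ≤-refl , W-W-walk4 wx wy

  module SeveralW (|W|≢1 : sizeW G inU ≢ 1) where

    U-ecc3 : ∀ {u} → U u → Ecc G u 3
    U-ecc3 uu = let w , ww , ¬uw = U-non-nbr |W|≢1 uu in
      Ecc-intro (U-within3 uu) (U-W-walk3 uu ww)
                (opposite-nonadjacent⇒Dist≥3 (U-W-opposite uu ww) ¬uw)

    far3 : ∀ x → ∃ λ y → Dist≥ x y 3
    far3 x with U⊎W x
    ... | inj₁ ux = let w , ww , ¬xw = U-non-nbr |W|≢1 ux in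
                    w , opposite-nonadjacent⇒Dist≥3 (U-W-opposite ux ww) ¬xw
    ... | inj₂ wx = let u , uu , ¬xu = W-non-nbr |W|≢1 wx in
                    u , opposite-nonadjacent⇒Dist≥3 (W-U-opposite wx uu) ¬xu

    rad : Rad G 3
    rad = Rad-intro (U-ecc3 (proj₂ U-nonempty)) far3

    Apart : V → V → Set
    Apart x y = W x × W y × ¬ Walk G 2 x y

    apart? : ∀ x y → Dec (Apart x y)
    apart? x y = (inU x B.≟ false) ×-dec (inU y B.≟ false) ×-dec ¬? (walk? 2 x y)

    diam : ∃ λ D → Diam G D × 3 ≤ D × D ≤ 4
    diam with any? (λ x → any? (apart? x))
    ... | yes (x , y , wx , wy , ¬xy) = 4 , Diam-intro ecc-x within4 , n≤1+n 3 , ≤-refl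
      where
      x≢y : x ≢ y
      x≢y refl = let v , xv = W-has-nbr wx in ¬xy (edge xv ++ edge (Adj-sym xv))
      ecc-x : Ecc G x 4
      ecc-x = Ecc-intro (within4 x) (W-W-walk4 wx wy) (same-side⇒Dist≥4 (trans wy (sym wx)) x≢y ¬xy)
    ... | no no-apart = 3 , Diam-intro (U-ecc3 (proj₂ U-nonempty)) within3 , ≤-refl , n≤1+n 3
      where
      within3 : ∀ x y → Dist≤ x y 3
      within3 x y with U⊎W x | U⊎W y
      ... | inj₁ ux | _       = U-within3 ux y
      ... | inj₂ wx | inj₁ uy = 3 , ≤-refl , W-U-walk3 wx uy
      ... | inj₂ wx | inj₂ wy =
        2 , n≤1+n 2 , decidable-stable (walk? 2 x y) λ ¬xy → no-apart (x , y , wx , wy , ¬xy)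

corollary2p7 : (G : Graph) (inU : Fin (n G) → Bool) → IsCircular G inU →
    (Trivial G inU → Diam G 2 × Rad G 1) ×
    (NonTrivial G inU → (∃ λ D → Diam G D × 3 ≤ D × D ≤ 4) × Rad G 3)
-- The hypothesis |U| ≠ 1 of a non-trivial circular graph is redundant (see |U|≢1).
corollary2p7 G inU C = [ ⊥-elim ∘ |U|≢1 , single-W ] , λ (_ , |W|≢1) → diam |W|≢1 , rad |W|≢1
  where
  open Circular G inU C
  open SeveralW
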